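{- Let $K>k\ge1$ and let $X=(L\sqcup R,E)$ be a finite $(K+1,k+1)$-biregular bipartite graph with non-backtracking operator $B$ on $L^2(E)$. Let $\gamma$ be a cycle in $X$, given by distinct vertices $\ell_1,\dots,\ell_m\in L$ and $r_1,\dots,r_m\in R$ ($m\ge2$) with $\ell_i\sim r_i$ and $r_i\sim\ell_{i+1}$ (indices mod $m$). Define $p_\gamma,n_\gamma:E\to\mathbb{C}$ by $p_\gamma(\ell_i\to r_i)=p_\gamma(\ell_{i+1}\leftarrow r_i)=1$, $p_\gamma(\ell_i\leftarrow r_i)=p_\gamma(\ell_{i+1}\to r_i)=-1$; $n_\gamma(\ell_i\to r_i)=n_\gamma(\ell_i\leftarrow r_i)=1$, $n_\gamma(\ell_{i+1}\leftarrow r_i)=n_\gamma(\ell_{i+1}\to r_i)=-1$; and $p_\gamma(e)=n_\gamma(e)=0$ for every directed edge $e$ not appearing in $\gamma$. Then: (1) $Bp_\gamma=p_\gamma$ and $Bn_\gamma=-n_\gamma$; (2) $p_\gamma\perp n_{\gamma'}$ for any two such cycles $\gamma,\gamma'$; (3) for every $f:L\sqcup R\to\mathbb{C}$, both $p_\gamma$ and $n_\gamma$ are orthogonal to each of $f_{\ell o},f_{ri},f_{\ell i},f_{ro}$.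
   Context: $E$ is the set of directed edges, $\ell\to r$ is the edge from $\ell\in L$ to $r\in R$ and $\ell\leftarrow r$ the edge from $r$ to $\ell$; $L^2(E)$ has the standard inner product. $(BF)(v\to u)=\sum_{w\sim u,\,w\ne v}F(u\to w)$. For $f:L\sqcup R\to\mathbb{C}$ and neighbors $\ell\in L,r\in R$: $f_{\ell o}(\ell\to r)=f(\ell)$, $f_{\ell o}(\ell\leftarrow r)=0$; $f_{ri}(\ell\to r)=f(r)$, $f_{ri}(\ell\leftarrow r)=0$; $f_{\ell i}(\ell\to r)=0$, $f_{\ell i}(\ell\leftarrow r)=f(\ell)$; $f_{ro}(\ell\to r)=0$, $f_{ro}(\ell\leftarrow r)=f(r)$. -}

module Defs where

open import Level using (Level)
open import Data.Nat using (ℕ; zero; suc; NonZero) renaming (_+_ to _+ℕ_)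
open import Data.Nat.DivMod using (_%_; m%n<n)
open import Data.Fin using (Fin; toℕ; fromℕ<) renaming (zero to fzero; suc to fsuc)
import Data.Fin.Properties as FinP
open import Data.Bool using (Bool; true; false; if_then_else_; _∧_; not; T)
open import Data.Sum using (_⊎_; inj₁; inj₂)
open import Relation.Nullary using (does)
open import Relation.Binary.PropositionalEquality using (_≡_)
open import Function.Definitions using (Injective)
open import Algebra.Bundles using (CommutativeRing)

_=ᶠ_ : ∀ {n} → Fin n → Fin n → Bool
i =ᶠ j = does (i FinP.≟ j)

count : ∀ {n} → (Fin n → Bool) → ℕ
count {zero}  P = 0
count {suc n} P = (if P fzero then 1 else 0) +ℕ count (λ j → P (fsuc j))

-- A finite bipartite graph with L = Fin a, R = Fin b; ℓ ∼ r iff T (adj ℓ r).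
-- (p,q)-biregular: every left vertex has degree p, every right vertex degree q.
record Biregular {a b : ℕ} (p q : ℕ) (adj : Fin a → Fin b → Bool) : Set where
  field
    degL : ∀ (x : Fin a) → count (λ y → adj x y) ≡ p
    degR : ∀ (y : Fin b) → count (λ x → adj x y) ≡ q

next : ∀ {m} .{{_ : NonZero m}} → Fin m → Fin m
next {m} i = fromℕ< (m%n<n (suc (toℕ i)) m)

-- A cycle ℓ_1 r_1 ℓ_2 r_2 … ℓ_m r_m (m = 2 + len ≥ 2) with distinct vertices,
-- ℓ_i ∼ r_i and r_i ∼ ℓ_{i+1} (indices mod m).
record Cycle {a b : ℕ} (adj : Fin a → Fin b → Bool) : Set where
  field
    len   : ℕ
    lv    : Fin (suc (suc len)) → Fin a
    rv    : Fin (suc (suc len)) → Fin b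
    lv-inj : Injective _≡_ _≡_ lv
    rv-inj : Injective _≡_ _≡_ rv
    adj₁  : ∀ i → T (adj (lv i) (rv i))
    adj₂  : ∀ i → T (adj (lv (next i)) (rv i))

-- Directed edges: (out , ℓ , r) is ℓ → r, (inn , ℓ , r) is ℓ ← r (from r to ℓ);
-- they are directed edges of X when T (adj ℓ r).
data Dir : Set where
  out inn : Dir

module WithRing {c ℓ' : Level} (Rg : CommutativeRing c ℓ') where
  open CommutativeRing Rg

  Σ : ∀ {n} → (Fin n → Carrier) → Carrier
  Σ {zero}  f = 0#
  Σ {suc n} f = f fzero + Σ (λ j → f (fsuc j))

  δ : Bool → Carrier
  δ true  = 1#
  δ false = 0#

  module _ {a b : ℕ} (adj : Fin a → Fin b → Bool) where

    -- functions on directed edges (values at non-edges are irrelevant)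
    EFun : Set c
    EFun = Dir → Fin a → Fin b → Carrier

    _≈E_ : EFun → EFun → Set ℓ'
    F ≈E G = ∀ d x y → T (adj x y) → F d x y ≈ G d x y

    ⟨_,_⟩ : EFun → EFun → Carrier
    ⟨ F , G ⟩ = Σ (λ x → Σ (λ y →
                  if adj x y then F out x y * G out x y + F inn x y * G inn x y else 0#))

    -- non-backtracking operator (BF)(v→u) = Σ_{w∼u, w≠v} F(u→w)
    B : EFun → EFun
    B F out x y = Σ (λ x' → δ (adj x' y ∧ not (x' =ᶠ x)) * F inn x' y)
    B F inn x y = Σ (λ y' → δ (adj x y' ∧ not (y' =ᶠ y)) * F out x y')

    negE : EFun → EFun
    negE F d x y = - F d x y

    pγ : Cycle adj → EFun
    pγ γ out x y = Σ (λ i → δ (x =ᶠ lv i ∧ y =ᶠ rv i) - δ (x =ᶠ lv (next i) ∧ y =ᶠ rv i))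
      where open Cycle γ
    pγ γ inn x y = Σ (λ i → δ (x =ᶠ lv (next i) ∧ y =ᶠ rv i) - δ (x =ᶠ lv i ∧ y =ᶠ rv i))
      where open Cycle γ

    nγ : Cycle adj → EFun
    nγ γ d x y = Σ (λ i → δ (x =ᶠ lv i ∧ y =ᶠ rv i) - δ (x =ᶠ lv (next i) ∧ y =ᶠ rv i))
      where open Cycle γ

    f-ℓo f-ri f-ℓi f-ro : (Fin a ⊎ Fin b → Carrier) → EFun
    f-ℓo f out x y = f (inj₁ x)
    f-ℓo f inn x y = 0#
    f-ri f out x y = f (inj₂ y)
    f-ri f inn x y = 0#
    f-ℓi f out x y = 0#
    f-ℓi f inn x y = f (inj₁ x)
    f-ro f out x y = 0#
    f-ro f inn x y = f (inj₂ y)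

{-# OPTIONS --safe #-}

-- Write P(ℓ, r) = Σᵢ [ℓ = ℓᵢ, r = rᵢ] − [ℓ = ℓᵢ₊₁, r = rᵢ].  Then p_γ and n_γ both equal P on
-- the edges ℓ → r, while on the edges ℓ ← r they equal −P and P respectively.  Read as a flow
-- along the edges from L to R, P is a circulation: it vanishes off the edges and sums to zero
-- at every vertex.  Since (B F)(ℓ → r) is the sum of F(ℓ' ← r) over all neighbours ℓ' of r
-- minus the excluded term F(ℓ ← r), and dually for (B F)(ℓ ← r), this gives (1); pairing with
-- a lifted vertex function is a vertex-weighted sum of P, which vanishes, giving (3); and (2)
-- holds edge by edge, p being odd and n even under reversal of edges.

module Submission where

open import Defs
open import Level using (Level)
open import Data.Nat using (ℕ; suc; _<_; _≤_; s≤s)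
open import Data.Nat.DivMod using (_%_; m<n⇒m%n≡m; n%n≡0)
open import Data.Fin using (Fin; fromℕ; inject₁) renaming (zero to fzero; suc to fsuc)
import Data.Fin.Properties as FinP
open import Data.Bool using (Bool; true; false; _∧_; not; T; if_then_else_)
open import Data.Sum using (_⊎_; inj₁; inj₂)
open import Data.Product using (_×_; _,_)
open import Data.Empty using (⊥-elim)
open import Function using (_∘_)
open import Relation.Nullary using (¬_; yes; no)
open import Relation.Binary.PropositionalEquality as ≡ using (_≡_)
open import Algebra.Bundles using (CommutativeRing)
import Algebra.Properties.Ring as RingProperties
import Algebra.Properties.Semiring.Sum as SemiringSum
import Relation.Binary.Reasoning.Setoid as SetoidReasoning

next-inject₁ : ∀ {n} (j : Fin n) → next {suc n} (inject₁ j) ≡ fsuc j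
next-inject₁ {n} j = FinP.toℕ-injective (≡.trans (FinP.toℕ-fromℕ< _)
  (≡.trans (≡.cong (λ t → suc t % suc n) (FinP.toℕ-inject₁ j))
     (m<n⇒m%n≡m (s≤s (FinP.toℕ<n j)))))

next-fromℕ : ∀ n → next {suc n} (fromℕ n) ≡ fzero
next-fromℕ n = FinP.toℕ-injective (≡.trans (FinP.toℕ-fromℕ< _)
  (≡.trans (≡.cong (λ t → suc t % suc n) (FinP.toℕ-fromℕ n)) (n%n≡0 (suc n))))

module CycleSpace {c ℓ : Level} (R : CommutativeRing c ℓ) where
  open CommutativeRing R
  open WithRing R
  open RingProperties ring
  open SemiringSum semiring
    using (sum; sum-cong-≋; sum-cong-≗; ∑-distrib-+; ∑-comm; *-distribʳ-sum; sum-init-last)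
  open SetoidReasoning setoid

  Σ≡sum : ∀ {n} (f : Fin n → Carrier) → Σ f ≡ sum f
  Σ≡sum {0}     f = ≡.refl
  Σ≡sum {suc n} f = ≡.cong (f fzero +_) (Σ≡sum (f ∘ fsuc))

  Σ-cong : ∀ {n} {f g : Fin n → Carrier} → (∀ i → f i ≈ g i) → Σ f ≈ Σ g
  Σ-cong {f = f} {g} f≈g rewrite Σ≡sum f | Σ≡sum g = sum-cong-≋ f≈g

  Σ-≈0 : ∀ {n} {f : Fin n → Carrier} → (∀ i → f i ≈ 0#) → Σ f ≈ 0#
  Σ-≈0 {0}     f≈0 = refl
  Σ-≈0 {suc n} f≈0 = trans (+-cong (f≈0 fzero) (Σ-≈0 (f≈0 ∘ fsuc))) (+-identityˡ 0#)

  Σ-distrib-+ : ∀ {n} (f g : Fin n → Carrier) → Σ (λ i → f i + g i) ≈ Σ f + Σ g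
  Σ-distrib-+ f g rewrite Σ≡sum (λ i → f i + g i) | Σ≡sum f | Σ≡sum g = ∑-distrib-+ f g

  Σ-neg : ∀ {n} (f : Fin n → Carrier) → Σ (λ i → - f i) ≈ - Σ f
  Σ-neg {0}     f = sym -0#≈0#
  Σ-neg {suc n} f = trans (+-congˡ (Σ-neg (f ∘ fsuc))) (-‿+-comm _ _)

  Σ-distrib-- : ∀ {n} (f g : Fin n → Carrier) → Σ (λ i → f i - g i) ≈ Σ f - Σ g
  Σ-distrib-- f g = trans (Σ-distrib-+ f (λ i → - g i)) (+-congˡ (Σ-neg g))

  Σ-*ʳ : ∀ {n} (f : Fin n → Carrier) x → Σ (λ i → f i * x) ≈ Σ f * x
  Σ-*ʳ f x rewrite Σ≡sum (λ i → f i * x) | Σ≡sum f = sym (*-distribʳ-sum x f)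

  Σ-comm : ∀ {m n} (f : Fin m → Fin n → Carrier) →
           Σ (λ i → Σ (λ j → f i j)) ≈ Σ (λ j → Σ (λ i → f i j))
  Σ-comm f = begin
    Σ (λ i → Σ (f i))                ≈⟨ Σ-cong (λ i → reflexive (Σ≡sum (f i))) ⟩
    Σ (λ i → sum (f i))              ≡⟨ Σ≡sum (λ i → sum (f i)) ⟩
    sum (λ i → sum (f i))            ≈⟨ ∑-comm f ⟩
    sum (λ j → sum (λ i → f i j))    ≡⟨ Σ≡sum (λ j → sum (λ i → f i j)) ⟨
    Σ (λ j → sum (λ i → f i j))      ≈⟨ Σ-cong (λ j → reflexive (Σ≡sum (λ i → f i j))) ⟨
    Σ (λ j → Σ (λ i → f i j))        ∎

  Σ-next : ∀ n (g : Fin (suc n) → Carrier) → Σ (g ∘ next) ≈ Σ g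
  Σ-next n g = begin
    Σ (g ∘ next)                                  ≡⟨ Σ≡sum (g ∘ next) ⟩
    sum (g ∘ next)                                ≈⟨ sum-init-last (g ∘ next) ⟩
    sum (g ∘ next ∘ inject₁) + g (next (fromℕ n))
      ≡⟨ ≡.cong₂ _+_ (sum-cong-≗ (≡.cong g ∘ next-inject₁)) (≡.cong g (next-fromℕ n)) ⟩
    sum (g ∘ fsuc) + g fzero                      ≈⟨ +-comm _ _ ⟩
    sum g                                         ≡⟨ Σ≡sum g ⟨
    Σ g                                           ∎

  Σ-δ-select : ∀ {n} (k : Fin n) (h : Fin n → Carrier) → Σ (λ j → δ (j =ᶠ k) * h j) ≈ h k
  Σ-δ-select fzero    h =
    trans (+-cong (*-identityˡ _) (Σ-≈0 (λ j → zeroˡ (h (fsuc j))))) (+-identityʳ _)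
  Σ-δ-select (fsuc k) h = trans (+-cong (zeroˡ _) (Σ-δ-select k (h ∘ fsuc))) (+-identityˡ _)

  δ-∧ : ∀ s t → δ (s ∧ t) ≈ δ s * δ t
  δ-∧ true  t = sym (*-identityˡ _)
  δ-∧ false t = sym (zeroˡ _)

  Σ-δ-∧ˡ : ∀ {n} (k : Fin n) t → Σ (λ j → δ (j =ᶠ k ∧ t)) ≈ δ t
  Σ-δ-∧ˡ k t = trans (Σ-cong (λ j → δ-∧ (j =ᶠ k) t)) (Σ-δ-select k (λ _ → δ t))

  Σ-δ-∧ʳ : ∀ {n} s (k : Fin n) → Σ (λ j → δ (s ∧ j =ᶠ k)) ≈ δ s
  Σ-δ-∧ʳ s k = trans (Σ-cong (λ j → trans (δ-∧ s (j =ᶠ k)) (*-comm _ _))) (Σ-δ-select k (λ _ → δ s))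

  δ-not-* : ∀ t x → δ (not t) * x ≈ x - δ t * x
  δ-not-* true  x = begin
    0# * x      ≈⟨ zeroˡ x ⟩
    0#          ≈⟨ -‿inverseʳ x ⟨
    x - x       ≈⟨ +-congˡ (-‿cong (*-identityˡ x)) ⟨
    x - 1# * x  ∎
  δ-not-* false x = begin
    1# * x      ≈⟨ *-identityˡ x ⟩
    x           ≈⟨ +-identityʳ x ⟨
    x + 0#      ≈⟨ +-congˡ (trans (-‿cong (zeroˡ x)) -0#≈0#) ⟨
    x - 0# * x  ∎

  δ-∧-not-* : ∀ s t {x} → (¬ T s → x ≈ 0#) → δ (s ∧ not t) * x ≈ x - δ t * x
  δ-∧-not-* true  t     _   = δ-not-* t _
  δ-∧-not-* false t {x} x≈0 = begin
    0# * x            ≈⟨ zeroˡ x ⟩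
    0#                ≈⟨ zeroʳ _ ⟨
    δ (not t) * 0#    ≈⟨ *-congˡ (x≈0 λ ()) ⟨
    δ (not t) * x     ≈⟨ δ-not-* t x ⟩
    x - δ t * x       ∎

  Σ-except : ∀ {n} (s : Fin n → Bool) (k : Fin n) (h : Fin n → Carrier) →
             (∀ j → ¬ T (s j) → h j ≈ 0#) →
             Σ (λ j → δ (s j ∧ not (j =ᶠ k)) * h j) ≈ Σ h - h k
  Σ-except s k h h≈0 = begin
    Σ (λ j → δ (s j ∧ not (j =ᶠ k)) * h j) ≈⟨ Σ-cong (λ j → δ-∧-not-* (s j) (j =ᶠ k) (h≈0 j)) ⟩
    Σ (λ j → h j - δ (j =ᶠ k) * h j)       ≈⟨ Σ-distrib-- h (λ j → δ (j =ᶠ k) * h j) ⟩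
    Σ h - Σ (λ j → δ (j =ᶠ k) * h j)       ≈⟨ +-congˡ (-‿cong (Σ-δ-select k h)) ⟩
    Σ h - h k                              ∎

  if-elim : ∀ s {x y} → (T s → x ≈ y) → (¬ T s → 0# ≈ y) → (if s then x else 0#) ≈ y
  if-elim true  on _  = on _
  if-elim false _  off = off λ ()

  x+y*0≈x : ∀ x y → x + y * 0# ≈ x
  x+y*0≈x x y = trans (+-congˡ (zeroʳ y)) (+-identityʳ x)

  x*0+y≈y : ∀ x y → x * 0# + y ≈ y
  x*0+y≈y x y = trans (+-congʳ (zeroʳ x)) (+-identityˡ y)

  module _ {a b : ℕ} (adj : Fin a → Fin b → Bool) where

    record IsCirculation (P : Fin a → Fin b → Carrier) : Set ℓ where
      field
        off-edge : ∀ x y → ¬ T (adj x y) → P x y ≈ 0#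
        row-sum  : ∀ x → Σ (P x) ≈ 0#
        col-sum  : ∀ y → Σ (λ x → P x y) ≈ 0#

      off-edge-* : ∀ x y {w} → ¬ T (adj x y) → P x y * w ≈ 0#
      off-edge-* x y ¬xy = trans (*-congʳ (off-edge x y ¬xy)) (zeroˡ _)

      Σ-weightedˡ : ∀ (g : Fin a → Carrier) → Σ (λ x → Σ (λ y → P x y * g x)) ≈ 0#
      Σ-weightedˡ g = Σ-≈0 (λ x → trans (Σ-*ʳ (P x) (g x)) (trans (*-congʳ (row-sum x)) (zeroˡ _)))

      Σ-weightedʳ : ∀ (h : Fin b → Carrier) → Σ (λ x → Σ (λ y → P x y * h y)) ≈ 0#
      Σ-weightedʳ h = trans (Σ-comm (λ x y → P x y * h y))
        (Σ-≈0 (λ y → trans (Σ-*ʳ (λ x → P x y) (h y)) (trans (*-congʳ (col-sum y)) (zeroˡ _))))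

    open IsCirculation

    IsCirculation-neg : ∀ {P Q} → (∀ x y → Q x y ≈ - P x y) → IsCirculation P → IsCirculation Q
    IsCirculation-neg {P} Q≈-P c = record
      { off-edge = λ x y ¬xy → trans (Q≈-P x y) (trans (-‿cong (off-edge c x y ¬xy)) -0#≈0#)
      ; row-sum  = λ x → trans (Σ-cong (Q≈-P x)) (neg≈0 (Σ-neg (P x)) (row-sum c x))
      ; col-sum  = λ y → trans (Σ-cong (λ x → Q≈-P x y)) (neg≈0 (Σ-neg (λ x → P x y)) (col-sum c y))
      }
      where
      neg≈0 : ∀ {s t} → s ≈ - t → t ≈ 0# → s ≈ 0#
      neg≈0 s≈-t t≈0 = trans s≈-t (trans (-‿cong t≈0) -0#≈0#)

    B-out : ∀ {F : EFun adj} → IsCirculation (F inn) → ∀ x y → B adj F out x y ≈ - F inn x y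
    B-out {F} c x y = begin
      B adj F out x y                    ≈⟨ Σ-except (λ x' → adj x' y) x (λ x' → F inn x' y)
                                                     (λ x' → off-edge c x' y) ⟩
      Σ (λ x' → F inn x' y) - F inn x y  ≈⟨ +-congʳ (col-sum c y) ⟩
      0# - F inn x y                     ≈⟨ +-identityˡ _ ⟩
      - F inn x y                        ∎

    B-inn : ∀ {F : EFun adj} → IsCirculation (F out) → ∀ x y → B adj F inn x y ≈ - F out x y
    B-inn {F} c x y = begin
      B adj F inn x y                    ≈⟨ Σ-except (adj x) y (F out x) (off-edge c x) ⟩
      Σ (F out x) - F out x y            ≈⟨ +-congʳ (row-sum c x) ⟩
      0# - F out x y                     ≈⟨ +-identityˡ _ ⟩
      - F out x y                        ∎

    IsOdd IsEven : EFun adj → Set ℓ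
    IsOdd  F = ∀ x y → F inn x y ≈ - F out x y
    IsEven F = ∀ x y → F inn x y ≈ F out x y

    B-odd : ∀ (F : EFun adj) → IsOdd F → IsCirculation (F out) → IsCirculation (F inn) →
            _≈E_ adj (B adj F) F
    B-odd F odd cₒ cᵢ out x y _ =
      trans (B-out {F} cᵢ x y) (trans (-‿cong (odd x y)) (-‿involutive _))
    B-odd F odd cₒ cᵢ inn x y _ = trans (B-inn {F} cₒ x y) (sym (odd x y))

    B-even : ∀ (F : EFun adj) → IsEven F → IsCirculation (F out) → IsCirculation (F inn) →
             _≈E_ adj (B adj F) (negE adj F)
    B-even F even cₒ cᵢ out x y _ = trans (B-out {F} cᵢ x y) (-‿cong (even x y))
    B-even F even cₒ cᵢ inn x y _ = trans (B-inn {F} cₒ x y) (-‿cong (sym (even x y)))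

    ⟨⟩-weighted : ∀ (F G : EFun adj) {P W : Fin a → Fin b → Carrier} → IsCirculation P →
                  (∀ x y → F out x y * G out x y + F inn x y * G inn x y ≈ P x y * W x y) →
                  ⟨_,_⟩ adj F G ≈ Σ (λ x → Σ (λ y → P x y * W x y))
    ⟨⟩-weighted F G c FG≈PW = Σ-cong (λ x → Σ-cong (λ y →
      if-elim (adj x y) (λ _ → FG≈PW x y) (λ ¬xy → sym (off-edge-* c x y ¬xy))))

    ⟨⟩-lifts : ∀ (F : EFun adj) → IsCirculation (F out) → IsCirculation (F inn) →
               ∀ (f : Fin a ⊎ Fin b → Carrier) →
               ⟨_,_⟩ adj F (f-ℓo adj f) ≈ 0# × ⟨_,_⟩ adj F (f-ri adj f) ≈ 0#
               × ⟨_,_⟩ adj F (f-ℓi adj f) ≈ 0# × ⟨_,_⟩ adj F (f-ro adj f) ≈ 0#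
    ⟨⟩-lifts F cₒ cᵢ f =
      trans (⟨⟩-weighted F (f-ℓo adj f) cₒ (λ _ _ → x+y*0≈x _ _)) (Σ-weightedˡ cₒ (f ∘ inj₁)) ,
      trans (⟨⟩-weighted F (f-ri adj f) cₒ (λ _ _ → x+y*0≈x _ _)) (Σ-weightedʳ cₒ (f ∘ inj₂)) ,
      trans (⟨⟩-weighted F (f-ℓi adj f) cᵢ (λ _ _ → x*0+y≈y _ _)) (Σ-weightedˡ cᵢ (f ∘ inj₁)) ,
      trans (⟨⟩-weighted F (f-ro adj f) cᵢ (λ _ _ → x*0+y≈y _ _)) (Σ-weightedʳ cᵢ (f ∘ inj₂))

    ⟨⟩-odd-even : ∀ (F G : EFun adj) → IsOdd F → IsEven G → ⟨_,_⟩ adj F G ≈ 0#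
    ⟨⟩-odd-even F G odd even = Σ-≈0 (λ x → Σ-≈0 (λ y →
      if-elim (adj x y) (λ _ → cancel x y) (λ _ → refl)))
      where
      cancel : ∀ x y → F out x y * G out x y + F inn x y * G inn x y ≈ 0#
      cancel x y = begin
        F out x y * G out x y + F inn x y * G inn x y    ≈⟨ +-congˡ (*-cong (odd x y) (even x y)) ⟩
        F out x y * G out x y + - F out x y * G out x y  ≈⟨ +-congˡ (-‿distribˡ-* _ _) ⟨
        F out x y * G out x y - F out x y * G out x y    ≈⟨ -‿inverseʳ _ ⟩
        0#                                               ∎

    off-edge⇒=ᶠ-∧-=ᶠ≡false : ∀ {x u y v} → T (adj u v) → ¬ T (adj x y) → (x =ᶠ u ∧ y =ᶠ v) ≡ false
    off-edge⇒=ᶠ-∧-=ᶠ≡false {x} {u} {y} {v} uv ¬xy with x FinP.≟ u | y FinP.≟ v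
    ... | yes ≡.refl | yes ≡.refl = ⊥-elim (¬xy uv)
    ... | yes _      | no _       = ≡.refl
    ... | no _       | _          = ≡.refl

    cycleFlow : Cycle adj → Fin a → Fin b → Carrier
    cycleFlow γ x y = Σ (λ i → δ (x =ᶠ lv i ∧ y =ᶠ rv i) - δ (x =ᶠ lv (next i) ∧ y =ᶠ rv i))
      where open Cycle γ

    cycleFlow-isCirculation : ∀ γ → IsCirculation (cycleFlow γ)
    cycleFlow-isCirculation γ = record { off-edge = off ; row-sum = row ; col-sum = col }
      where
      open Cycle γ

      off : ∀ x y → ¬ T (adj x y) → cycleFlow γ x y ≈ 0#
      off x y ¬xy = Σ-≈0 (λ i → trans
        (+-cong (reflexive (≡.cong δ (off-edge⇒=ᶠ-∧-=ᶠ≡false (adj₁ i) ¬xy)))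
                (-‿cong (reflexive (≡.cong δ (off-edge⇒=ᶠ-∧-=ᶠ≡false (adj₂ i) ¬xy)))))
        (trans (+-congˡ -0#≈0#) (+-identityʳ 0#)))

      row : ∀ x → Σ (cycleFlow γ x) ≈ 0#
      row x = begin
        Σ (cycleFlow γ x)
          ≈⟨ Σ-comm (λ y i → δ (x =ᶠ lv i ∧ y =ᶠ rv i) - δ (x =ᶠ lv (next i) ∧ y =ᶠ rv i)) ⟩
        Σ (λ i → Σ (λ y → δ (x =ᶠ lv i ∧ y =ᶠ rv i) - δ (x =ᶠ lv (next i) ∧ y =ᶠ rv i)))
          ≈⟨ Σ-cong (λ i → trans (Σ-distrib-- {b} _ _)
               (+-cong (Σ-δ-∧ʳ (x =ᶠ lv i) (rv i)) (-‿cong (Σ-δ-∧ʳ (x =ᶠ lv (next i)) (rv i))))) ⟩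
        Σ (λ i → δ (x =ᶠ lv i) - δ (x =ᶠ lv (next i)))
          ≈⟨ Σ-distrib-- (λ i → δ (x =ᶠ lv i)) (λ i → δ (x =ᶠ lv (next i))) ⟩
        Σ (λ i → δ (x =ᶠ lv i)) - Σ (λ i → δ (x =ᶠ lv (next i)))
          ≈⟨ +-congˡ (-‿cong (Σ-next (suc len) (λ i → δ (x =ᶠ lv i)))) ⟩
        Σ (λ i → δ (x =ᶠ lv i)) - Σ (λ i → δ (x =ᶠ lv i))
          ≈⟨ -‿inverseʳ _ ⟩
        0# ∎

      col : ∀ y → Σ (λ x → cycleFlow γ x y) ≈ 0#
      col y = trans (Σ-comm (λ x i → δ (x =ᶠ lv i ∧ y =ᶠ rv i) - δ (x =ᶠ lv (next i) ∧ y =ᶠ rv i)))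
        (Σ-≈0 (λ i → trans (Σ-distrib-- {a} _ _)
          (trans (+-cong (Σ-δ-∧ˡ (lv i) (y =ᶠ rv i)) (-‿cong (Σ-δ-∧ˡ (lv (next i)) (y =ᶠ rv i))))
                 (-‿inverseʳ _))))

    pγ-odd : ∀ γ → IsOdd (pγ adj γ)
    pγ-odd γ x y = begin
      Σ (λ i → e′ i - e i)    ≈⟨ Σ-cong (λ i → ⁻¹-anti-homo‿- (e i) (e′ i)) ⟨
      Σ (λ i → - (e i - e′ i)) ≈⟨ Σ-neg (λ i → e i - e′ i) ⟩
      - Σ (λ i → e i - e′ i)   ∎
      where
      open Cycle γ
      e e′ : Fin (suc (suc len)) → Carrier
      e i  = δ (x =ᶠ lv i ∧ y =ᶠ rv i)
      e′ i = δ (x =ᶠ lv (next i) ∧ y =ᶠ rv i)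

    nγ-even : ∀ γ → IsEven (nγ adj γ)
    nγ-even γ x y = refl

proposition3p9 : ∀ {c ℓ' : Level} (Rg : CommutativeRing c ℓ') (K k a b : ℕ)
    (adj : Fin a → Fin b → Bool) → k < K → 1 ≤ k → Biregular (suc K) (suc k) adj →
    let open CommutativeRing Rg
        open WithRing Rg
    in (∀ (γ : Cycle adj) → _≈E_ adj (B adj (pγ adj γ)) (pγ adj γ)
                          × _≈E_ adj (B adj (nγ adj γ)) (negE adj (nγ adj γ)))
     × (∀ (γ γ' : Cycle adj) → ⟨_,_⟩ adj (pγ adj γ) (nγ adj γ') ≈ 0#)
     × (∀ (γ : Cycle adj) (f : Fin a ⊎ Fin b → Carrier) →
          (⟨_,_⟩ adj (pγ adj γ) (f-ℓo adj f) ≈ 0# × ⟨_,_⟩ adj (pγ adj γ) (f-ri adj f) ≈ 0#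
           × ⟨_,_⟩ adj (pγ adj γ) (f-ℓi adj f) ≈ 0# × ⟨_,_⟩ adj (pγ adj γ) (f-ro adj f) ≈ 0#)
        × (⟨_,_⟩ adj (nγ adj γ) (f-ℓo adj f) ≈ 0# × ⟨_,_⟩ adj (nγ adj γ) (f-ri adj f) ≈ 0#
           × ⟨_,_⟩ adj (nγ adj γ) (f-ℓi adj f) ≈ 0# × ⟨_,_⟩ adj (nγ adj γ) (f-ro adj f) ≈ 0#))
proposition3p9 Rg K k a b adj _ _ _ =
  (λ γ → B-odd adj (pγ adj γ) (pγ-odd adj γ) (flow γ) (flow-inn γ)
       , B-even adj (nγ adj γ) (nγ-even adj γ) (flow γ) (flow γ)) ,
  (λ γ γ' → ⟨⟩-odd-even adj (pγ adj γ) (nγ adj γ') (pγ-odd adj γ) (nγ-even adj γ')) ,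
  (λ γ f → ⟨⟩-lifts adj (pγ adj γ) (flow γ) (flow-inn γ) f
         , ⟨⟩-lifts adj (nγ adj γ) (flow γ) (flow γ) f)
  where
  open WithRing Rg using (pγ; nγ)
  open CycleSpace Rg

  flow : ∀ γ → IsCirculation adj (cycleFlow adj γ)
  flow = cycleFlow-isCirculation adj

  flow-inn : ∀ γ → IsCirculation adj (pγ adj γ inn)
  flow-inn γ = IsCirculation-neg adj (pγ-odd adj γ) (flow γ)
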